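{- Let $R$ be a unique factorization domain of prime characteristic $p>0$. Let $P,Q\in R$ be non-zero and let $U$ be the Lucas sequence with parameters $P,Q$, assumed regular. Let $\mathfrak{p}$ be a prime element of $R$ whose rank of appearance $\rho=\rho_U(\mathfrak{p})$ is finite, and let $\Delta=P^2-4Q$. Then for every integer $n\geq1$, \[ v_\mathfrak{p}(U_{\rho n}) = p^{v_p(n)} v_\mathfrak{p}(U_\rho) + \frac{(p^{v_p(n)}-1)\,v_\mathfrak{p}(\Delta)}{2}, \] where $v_p(n)$ is the $p$-adic valuation of the integer $n$ and $v_\mathfrak{p}$ is the $\mathfrak{p}$-adic valuation on $R$.
   Context: The Lucas sequence with parameters $P,Q$ is defined by $U_0=0$, $U_1=1$, $U_{n+2}=PU_{n+1}-QU_n$ ($n\ge0$). It is non-degenerate if $U_n\neq 0$ for all $n\ge1$, and regular if it is non-degenerate and $(P)+(Q)=R$. For a proper ideal $\mathfrak{a}$ of $R$, the rank of appearance $\rho_U(\mathfrak{a})$ is the least integer $n\geq1$ with $U_n\in\mathfrak{a}$ (or $+\infty$ if none exists); for a prime element $\mathfrak{p}$, $\rho_U(\mathfrak{p})=\rho_U((\mathfrak{p}))$. -}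

module Defs where

open import Level using (_⊔_)
open import Algebra.Bundles using (CommutativeRing)
open import Data.Nat as ℕ using (ℕ; zero; suc)
import Data.Nat.Divisibility as ℕD
open import Data.Nat.Primality using (Prime)
open import Data.Product using (Σ; ∃; ∃₂; _×_; _,_)
open import Data.Sum using (_⊎_)
open import Data.List using (List; []; _∷_; foldr)
open import Data.List.Relation.Unary.All using (All)
open import Data.List.Relation.Binary.Pointwise using (Pointwise)
open import Data.List.Relation.Binary.Permutation.Propositional using (_↭_)
open import Relation.Nullary using (¬_)

IsNatVal : ℕ → ℕ → ℕ → Set
IsNatVal p n k = (p ℕ.^ k) ℕD.∣ n × ¬ ((p ℕ.^ suc k) ℕD.∣ n)

module _ {c ℓ} (R : CommutativeRing c ℓ) where
  open CommutativeRing R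

  Divides : Carrier → Carrier → Set (c ⊔ ℓ)
  Divides a b = ∃ λ q → q * a ≈ b

  IsUnit : Carrier → Set (c ⊔ ℓ)
  IsUnit u = ∃ λ v → u * v ≈ 1#

  Associated : Carrier → Carrier → Set (c ⊔ ℓ)
  Associated a b = ∃ λ u → IsUnit u × a ≈ u * b

  power : Carrier → ℕ → Carrier
  power x zero = 1#
  power x (suc k) = x * power x k

  prod : List Carrier → Carrier
  prod = foldr _*_ 1#

  natCast : ℕ → Carrier
  natCast zero = 0#
  natCast (suc n) = 1# + natCast n

  IsIntegralDomain : Set (c ⊔ ℓ)
  IsIntegralDomain = ¬ (1# ≈ 0#) × (∀ x y → x * y ≈ 0# → x ≈ 0# ⊎ y ≈ 0#)

  IsIrreducible : Carrier → Set (c ⊔ ℓ)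
  IsIrreducible x = ¬ (x ≈ 0#) × ¬ IsUnit x
                  × (∀ a b → a * b ≈ x → IsUnit a ⊎ IsUnit b)

  IsPrimeElement : Carrier → Set (c ⊔ ℓ)
  IsPrimeElement π = ¬ (π ≈ 0#) × ¬ IsUnit π
                   × (∀ a b → Divides π (a * b) → Divides π a ⊎ Divides π b)

  IsUFD : Set (c ⊔ ℓ)
  IsUFD = IsIntegralDomain
        × (∀ x → ¬ (x ≈ 0#) → ¬ IsUnit x →
             ∃ λ xs → All IsIrreducible xs × prod xs ≈ x)
        × (∀ xs ys → All IsIrreducible xs → All IsIrreducible ys →
             prod xs ≈ prod ys →
             ∃ λ zs → ys ↭ zs × Pointwise Associated xs zs)

  HasCharacteristic : ℕ → Set ℓ
  HasCharacteristic p = natCast p ≈ 0#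
                      × (∀ m → 1 ℕ.≤ m → natCast m ≈ 0# → p ℕ.≤ m)

  lucasU : Carrier → Carrier → ℕ → Carrier
  lucasU P Q zero = 0#
  lucasU P Q (suc zero) = 1#
  lucasU P Q (suc (suc n)) = P * lucasU P Q (suc n) - Q * lucasU P Q n

  NonDegenerate : Carrier → Carrier → Set ℓ
  NonDegenerate P Q = ∀ n → 1 ℕ.≤ n → ¬ (lucasU P Q n ≈ 0#)

  Regular : Carrier → Carrier → Set (c ⊔ ℓ)
  Regular P Q = NonDegenerate P Q × ∃₂ λ x y → x * P + y * Q ≈ 1#

  IsRankOfAppearance : Carrier → Carrier → Carrier → ℕ → Set (c ⊔ ℓ)
  IsRankOfAppearance P Q π ρ = 1 ℕ.≤ ρ × Divides π (lucasU P Q ρ)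
                             × (∀ m → 1 ℕ.≤ m → m ℕ.< ρ → ¬ Divides π (lucasU P Q m))

  IsVal : Carrier → Carrier → ℕ → Set (c ⊔ ℓ)
  IsVal π x k = Divides π' x × ¬ Divides (π * π') x
    where π' = power π k

  discriminant : Carrier → Carrier → Carrier
  discriminant P Q = P * P - natCast 4 * Q

-- Adjoin a root α of X² − PX + Q to R and put β = P − α, δ = α − β.  Then α^n = β^n + U_n δ and
-- δ² = Δ.  In characteristic p the map x ↦ x^p is additive, so
--   β^(mp) + U_(mp) δ = α^(mp) = (β^m + U_m δ)^p = β^(mp) + U_m^p δ^p,
-- hence U_(mp) δ = U_m^p δ^p and, squaring, U_(mp)² Δ = (U_m² Δ)^p.  Taking π-adic valuations,
-- 2 v(U_(mp)) + v(Δ) = p (2 v(U_m) + v(Δ)); the valuation of U_(mp) exists because it can be read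
-- off from this identity.  Write n = j p^k with p ∤ j.  Iterating k times from m = jρ gives the
-- formula once v(U_(jρ)) = v(U_ρ).  For that, U_(jρ) = U_ρ W_j with W_j ≡ j U_(ρ+1)^(j−1) mod U_ρ;
-- j is a unit of R since p ∤ j, and π ∤ U_(ρ+1) because π ∤ Q (as (P) + (Q) = R) and then π
-- cannot divide two consecutive terms.
module Submission where

open import Algebra.Bundles using (CommutativeRing; CommutativeSemiring; CommutativeMonoid)
import Algebra.Construct.DirectProduct as DirectProduct
open import Algebra.Solver.Ring.AlmostCommutativeRing using (_-Raw-AlmostCommutative⟶_; fromCommutativeRing)
open import Algebra.Structures.Biased using (isCommutativeSemiringˡ; isCommutativeMonoidˡ)
open import Data.Empty using (⊥-elim)
open import Data.Fin as Fin using (Fin; toℕ; inject₁; fromℕ)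
import Data.Fin.Properties as Fin
import Data.Integer as ℤ
import Data.Integer.Properties as ℤ
open import Data.Maybe using (Maybe; just; nothing)
open import Data.Nat as ℕ using (ℕ; zero; suc; _≤_; _<_; z≤n; s≤s; _∸_; _!)
import Data.Nat.Properties as ℕ
import Data.Nat.Divisibility as ℕ
open import Data.Nat.Combinatorics using (_C_; nCn≡1; k![n∸k]!∣n!)
open import Data.Nat.Combinatorics.Specification using (nCk≡n!/k![n-k]!)
open import Data.Nat.Coprimality using (Coprime; coprime-Bézout)
open import Data.Nat.DivMod using (m/n*n≡m)
import Data.Nat.GCD as GCD
open import Data.Nat.Primality using (Prime; euclidsLemma; prime⇒irreducible; prime⇒nonTrivial; prime⇒nonZero)
open import Data.Product using (∃; ∃₂; _×_; _,_; proj₁; proj₂)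
open import Data.Sign as Sign using (Sign)
open import Data.Sum using (_⊎_; inj₁; inj₂; [_,_]′)
open import Function using (_∘_)
open import Level using (_⊔_)
open import Relation.Binary.PropositionalEquality as ≡ using (_≡_)
open import Relation.Nullary using (¬_; yes; no)

open import Defs

-- Binomial coefficients at a prime and the Frobenius map

n∣n! : ∀ n .{{_ : ℕ.NonZero n}} → n ℕ.∣ n !
n∣n! (suc n) = ℕ.m∣m*n (n !)

module _ {p : ℕ} (p-prime : Prime p) where

  prime∤⇒coprime : ∀ {j} → p ℕ.∤ j → Coprime p j
  prime∤⇒coprime p∤j (d∣p , d∣j) with prime⇒irreducible p-prime d∣p
  ... | inj₁ d≡1 = d≡1
  ... | inj₂ d≡p = ⊥-elim (p∤j (≡.subst (ℕ._∣ _) d≡p d∣j))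

  private
    1<p : 1 < p
    1<p = ℕ.nonTrivial⇒n>1 p ⦃ prime⇒nonTrivial p-prime ⦄

  prime∤! : ∀ {j} → j < p → p ℕ.∤ j !
  prime∤! {zero}  _   p∣1  = ℕ.<⇒≱ 1<p (ℕ.∣⇒≤ p∣1)
  prime∤! {suc i} i<p p∣j! with euclidsLemma (suc i) (i !) p-prime p∣j!
  ... | inj₁ p∣j  = ℕ.<⇒≱ i<p (ℕ.∣⇒≤ p∣j)
  ... | inj₂ p∣i! = prime∤! (ℕ.<-trans (ℕ.n<1+n i) i<p) p∣i!

  -- p! = (p C k) k! (p-k)!, and p divides neither factorial.
  prime∣C : ∀ {k} → 0 < k → k < p → p ℕ.∣ p C k
  prime∣C {k} 0<k k<p
    with euclidsLemma (p C k) (k ! ℕ.* (p ∸ k) !) p-prime (≡.subst (p ℕ.∣_) p!≡ (n∣n! p ⦃ prime⇒nonZero p-prime ⦄))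
    where
      instance
        k![p∸k]!≢0 : ℕ.NonZero (k ! ℕ.* (p ∸ k) !)
        k![p∸k]!≢0 = ℕ.m*n≢0 (k !) ((p ∸ k) !) ⦃ ℕ._!≢0 k ⦄ ⦃ ℕ._!≢0 (p ∸ k) ⦄
      p!≡ : p ! ≡ (p C k) ℕ.* (k ! ℕ.* (p ∸ k) !)
      p!≡ = ≡.trans (≡.sym (m/n*n≡m (k![n∸k]!∣n! (ℕ.<⇒≤ k<p))))
                    (≡.cong (ℕ._* (k ! ℕ.* (p ∸ k) !)) (≡.sym (nCk≡n!/k![n-k]! (ℕ.<⇒≤ k<p))))
  ... | inj₁ p∣C = p∣C
  ... | inj₂ p∣k![p-k]! with euclidsLemma (k !) ((p ∸ k) !) p-prime p∣k![p-k]!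
  ...   | inj₁ p∣k!     = ⊥-elim (prime∤! k<p p∣k!)
  ...   | inj₂ p∣[p-k]! = ⊥-elim (prime∤! (ℕ.∸-monoʳ-< {p} {k} {0} 0<k (ℕ.<⇒≤ k<p)) p∣[p-k]!)

module _ {a ℓ} (S : CommutativeSemiring a ℓ) where
  open CommutativeSemiring S
  open import Algebra.Properties.Semiring.Mult semiring renaming (_×_ to _·_)
  open import Algebra.Properties.Semiring.Exp semiring
  open import Algebra.Properties.CommutativeSemiring.Binomial S using (theorem; binomial; binomialTerm)
  open import Algebra.Properties.Semiring.Sum semiring
  open import Relation.Binary.Reasoning.Setoid setoid

  ·-annihilate : ∀ {p n} → p · 1# ≈ 0# → p ℕ.∣ n → ∀ x → n · x ≈ 0#
  ·-annihilate {p} char (ℕ.divides q ≡.refl) x = begin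
    (q ℕ.* p) · x           ≈⟨ ×-congʳ (q ℕ.* p) (*-identityˡ x) ⟨
    (q ℕ.* p) · (1# * x)    ≈⟨ ×-assoc-* (q ℕ.* p) 1# x ⟨
    ((q ℕ.* p) · 1#) * x    ≈⟨ *-congʳ (×1-homo-* q p) ⟩
    ((q · 1#) * (p · 1#)) * x ≈⟨ *-congʳ (*-congˡ char) ⟩
    ((q · 1#) * 0#) * x     ≈⟨ *-congʳ (zeroʳ _) ⟩
    0# * x                  ≈⟨ zeroˡ x ⟩
    0#                      ∎

  frobenius : ∀ {p} → Prime p → p · 1# ≈ 0# → ∀ x y → (x + y) ^ p ≈ x ^ p + y ^ p
  frobenius {suc (suc p')} p-prime char x y = begin
    (x + y) ^ p                                          ≈⟨ theorem p x y ⟩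
    term Fin.zero + sum (λ k → term (Fin.suc k))         ≈⟨ +-congˡ (sum-init-last (λ k → term (Fin.suc k))) ⟩
    term Fin.zero + (sum (λ j → term (Fin.suc (inject₁ j))) + term (Fin.suc (fromℕ (suc p'))))
      ≈⟨ +-cong first (+-cong middle last) ⟩
    y ^ p + (0# + x ^ p)                                 ≈⟨ +-congˡ (+-identityˡ _) ⟩
    y ^ p + x ^ p                                        ≈⟨ +-comm _ _ ⟩
    x ^ p + y ^ p                                        ∎
    where
      p : ℕ
      p = suc (suc p')
      term : Fin (suc p) → Carrier
      term = binomialTerm x y p
      first : term Fin.zero ≈ y ^ p
      first = trans (+-identityʳ _) (*-identityˡ _)
      last : term (Fin.suc (fromℕ (suc p'))) ≈ x ^ p
      last = begin
        term (Fin.suc (fromℕ (suc p')))  ≡⟨ ≡.cong (λ k → (p C k) · (x ^ k * y ^ (p ∸ k))) (≡.cong suc (Fin.toℕ-fromℕ (suc p'))) ⟩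
        (p C p) · (x ^ p * y ^ (p ∸ p))  ≡⟨ ≡.cong₂ (λ c e → c · (x ^ p * y ^ e)) (nCn≡1 p) (ℕ.n∸n≡0 p) ⟩
        1 · (x ^ p * 1#)                 ≈⟨ +-identityʳ _ ⟩
        x ^ p * 1#                       ≈⟨ *-identityʳ _ ⟩
        x ^ p                            ∎
      middle : sum (λ j → term (Fin.suc (inject₁ j))) ≈ 0#
      middle = trans (sum-cong-≋ λ j → ·-annihilate char (prime∣C p-prime (s≤s z≤n) (s≤s (inner j))) (binomial x y p (Fin.suc (inject₁ j))))
                     (sum-replicate-zero (suc p'))
        where
          inner : ∀ (j : Fin (suc p')) → toℕ (inject₁ j) < suc p'
          inner j = ≡.subst (_< suc p') (≡.sym (Fin.toℕ-inject₁ j)) (Fin.toℕ<n j)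

module IntegerCoefficientSolver {c ℓ} (R : CommutativeRing c ℓ) where
  open CommutativeRing R
  open import Algebra.Properties.Ring ring using (-0#≈0#; -1*x≈-x)
  open import Algebra.Properties.AbelianGroup +-abelianGroup using (⁻¹-∙-comm; ⁻¹-involutive)
  open import Algebra.Properties.CommutativeSemigroup +-commutativeSemigroup
    using () renaming (interchange to +-interchange)
  open import Algebra.Properties.CommutativeSemigroup *-commutativeSemigroup
    using () renaming (interchange to *-interchange)
  open import Algebra.Properties.Semiring.Mult.TCOptimised semiring
    using (1+×; ×-homo-+; ×1-homo-*) renaming (_×_ to _·_)
  open import Relation.Binary.Reasoning.Setoid setoid

  -- The optimised multiple _·_ makes the solver constants 0, 1 and 2 denote 0#, 1# and 1# + 1# on the nose.
  fromℤ : ℤ.ℤ → Carrier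
  fromℤ (ℤ.+ n)    = n · 1#
  fromℤ ℤ.-[1+ n ] = - (suc n · 1#)

  natCast≈· : ∀ n → natCast R n ≈ n · 1#
  natCast≈· zero    = refl
  natCast≈· (suc n) = trans (+-congˡ (natCast≈· n)) (sym (1+× n 1#))

  fromℤ-⊖ : ∀ m n → fromℤ (m ℤ.⊖ n) ≈ m · 1# - n · 1#
  fromℤ-⊖ zero    zero    = sym (trans (+-congˡ -0#≈0#) (+-identityʳ 0#))
  fromℤ-⊖ (suc m) zero    = sym (trans (+-congˡ -0#≈0#) (+-identityʳ _))
  fromℤ-⊖ zero    (suc n) = sym (+-identityˡ _)
  fromℤ-⊖ (suc m) (suc n) = begin
    fromℤ (suc m ℤ.⊖ suc n)      ≡⟨ ≡.cong fromℤ (ℤ.[1+m]⊖[1+n]≡m⊖n m n) ⟩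
    fromℤ (m ℤ.⊖ n)              ≈⟨ fromℤ-⊖ m n ⟩
    x - y                      ≈⟨ +-identityˡ _ ⟨
    0# + (x - y)               ≈⟨ +-congʳ (-‿inverseʳ 1#) ⟨
    (1# - 1#) + (x - y)        ≈⟨ +-interchange 1# (- 1#) x (- y) ⟩
    (1# + x) + (- 1# - y)      ≈⟨ +-cong (1+× m 1#) (trans (-‿cong (1+× n 1#)) (sym (⁻¹-∙-comm 1# y))) ⟨
    suc m · 1# - suc n · 1#    ∎
    where
      x y : Carrier
      x = m · 1#
      y = n · 1#

  fromℤ-+ : ∀ i j → fromℤ (i ℤ.+ j) ≈ fromℤ i + fromℤ j
  fromℤ-+ (ℤ.+ m)    (ℤ.+ n)    = ×-homo-+ 1# m n
  fromℤ-+ (ℤ.+ m)    ℤ.-[1+ n ] = fromℤ-⊖ m (suc n)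
  fromℤ-+ ℤ.-[1+ m ] (ℤ.+ n)    = trans (fromℤ-⊖ n (suc m)) (+-comm _ _)
  fromℤ-+ ℤ.-[1+ m ] ℤ.-[1+ n ] = begin
    - (suc (suc (m ℕ.+ n)) · 1#)          ≡⟨ ≡.cong (λ k → - (suc k · 1#)) (ℕ.+-suc m n) ⟨
    - ((suc m ℕ.+ suc n) · 1#)            ≈⟨ -‿cong (×-homo-+ 1# (suc m) (suc n)) ⟩
    - (suc m · 1# + suc n · 1#)           ≈⟨ ⁻¹-∙-comm _ _ ⟨
    - (suc m · 1#) - suc n · 1#           ∎

  signValue : Sign → Carrier
  signValue Sign.+ = 1#
  signValue Sign.- = - 1#

  signValue-* : ∀ s t → signValue (s Sign.* t) ≈ signValue s * signValue t
  signValue-* Sign.+ t      = sym (*-identityˡ _)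
  signValue-* Sign.- Sign.+ = sym (*-identityʳ _)
  signValue-* Sign.- Sign.- = begin
    1#                   ≈⟨ ⁻¹-involutive 1# ⟨
    - - 1#               ≈⟨ -‿cong (-1*x≈-x 1#) ⟨
    - (- 1# * 1#)        ≈⟨ -1*x≈-x _ ⟨
    - 1# * (- 1# * 1#)   ≈⟨ *-congˡ (*-identityʳ _) ⟩
    - 1# * - 1#          ∎

  fromℤ-◃ : ∀ s n → fromℤ (s ℤ.◃ n) ≈ signValue s * (n · 1#)
  fromℤ-◃ s      zero    = sym (zeroʳ _)
  fromℤ-◃ Sign.+ (suc n) = sym (*-identityˡ _)
  fromℤ-◃ Sign.- (suc n) = sym (-1*x≈-x _)

  fromℤ-* : ∀ i j → fromℤ (i ℤ.* j) ≈ fromℤ i * fromℤ j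
  fromℤ-* i j = begin
    fromℤ (s Sign.* t ℤ.◃ ℤ.∣ i ∣ ℕ.* ℤ.∣ j ∣)                     ≈⟨ fromℤ-◃ (s Sign.* t) (ℤ.∣ i ∣ ℕ.* ℤ.∣ j ∣) ⟩
    signValue (s Sign.* t) * ((ℤ.∣ i ∣ ℕ.* ℤ.∣ j ∣) · 1#)         ≈⟨ *-cong (signValue-* s t) (×1-homo-* ℤ.∣ i ∣ ℤ.∣ j ∣) ⟩
    (signValue s * signValue t) * (ℤ.∣ i ∣ · 1# * ℤ.∣ j ∣ · 1#)  ≈⟨ *-interchange _ _ _ _ ⟩
    (signValue s * ℤ.∣ i ∣ · 1#) * (signValue t * ℤ.∣ j ∣ · 1#)  ≈⟨ *-cong (fromℤ-◃ s ℤ.∣ i ∣) (fromℤ-◃ t ℤ.∣ j ∣) ⟨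
    fromℤ (s ℤ.◃ ℤ.∣ i ∣) * fromℤ (t ℤ.◃ ℤ.∣ j ∣)                     ≡⟨ ≡.cong₂ (λ a b → fromℤ a * fromℤ b) (ℤ.◃-inverse i) (ℤ.◃-inverse j) ⟩
    fromℤ i * fromℤ j                                          ∎
    where
      s t : Sign
      s = ℤ.sign i
      t = ℤ.sign j

  fromℤ-neg : ∀ i → fromℤ (ℤ.- i) ≈ - fromℤ i
  fromℤ-neg (ℤ.+ zero)  = sym -0#≈0#
  fromℤ-neg (ℤ.+ suc n) = refl
  fromℤ-neg ℤ.-[1+ n ]  = sym (⁻¹-involutive _)

  fromℤ-homomorphism : ℤ.+-*-rawRing -Raw-AlmostCommutative⟶ fromCommutativeRing R
  fromℤ-homomorphism = record
    { ⟦_⟧ = fromℤ ; +-homo = fromℤ-+ ; *-homo = fromℤ-* ; -‿homo = fromℤ-neg ; 0-homo = refl ; 1-homo = refl }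

  fromℤ-≟ : ∀ i j → Maybe (fromℤ i ≈ fromℤ j)
  fromℤ-≟ i j with i ℤ.≟ j
  ... | yes ≡.refl = just refl
  ... | no _       = nothing

  open import Algebra.Solver.Ring ℤ.+-*-rawRing (fromCommutativeRing R) fromℤ-homomorphism fromℤ-≟ public

-- R[α] with α² = Pα − Q; the pair (a , b) stands for a + bα.
module QuadraticAlgebra {c ℓ} (R : CommutativeRing c ℓ) (P Q : CommutativeRing.Carrier R) where
  open CommutativeRing R
  open IntegerCoefficientSolver R
  private
    module A = CommutativeMonoid (DirectProduct.commutativeMonoid +-commutativeMonoid +-commutativeMonoid)

  infixl 7 _⊗_
  _⊗_ : A.Carrier → A.Carrier → A.Carrier
  (a , b) ⊗ (c , d) = a * c - Q * (b * d) , a * d + b * c + P * (b * d)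

  R[α] : CommutativeSemiring c ℓ
  R[α] = record
    { _≈_ = A._≈_ ; _+_ = A._∙_ ; _*_ = _⊗_ ; 0# = A.ε ; 1# = 1# , 0#
    ; isCommutativeSemiring = isCommutativeSemiringˡ record
      { +-isCommutativeMonoid = A.isCommutativeMonoid
      ; *-isCommutativeMonoid = isCommutativeMonoidˡ record
        { isSemigroup = record
          { isMagma = record { isEquivalence = A.isEquivalence ; ∙-cong = ⊗-cong }
          ; assoc = ⊗-assoc }
        ; identityˡ = ⊗-identityˡ
        ; comm = ⊗-comm }
      ; distribʳ = ⊗-distribʳ
      ; zeroˡ = ⊗-zeroˡ } }
    where
      ⊗-cong : ∀ {x x′ y y′} → x A.≈ x′ → y A.≈ y′ → x ⊗ y A.≈ x′ ⊗ y′
      ⊗-cong (a≈ , b≈) (c≈ , d≈) =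
        +-cong (*-cong a≈ c≈) (-‿cong (*-congˡ (*-cong b≈ d≈))) ,
        +-cong (+-cong (*-cong a≈ d≈) (*-cong b≈ c≈)) (*-congˡ (*-cong b≈ d≈))
      ⊗-assoc : ∀ x y z → (x ⊗ y) ⊗ z A.≈ x ⊗ (y ⊗ z)
      ⊗-assoc (a , b) (c , d) (e , f) =
        solve 8 (λ P Q a b c d e f → (a :* c :- Q :* (b :* d)) :* e :- Q :* ((a :* d :+ b :* c :+ P :* (b :* d)) :* f)
                  := a :* (c :* e :- Q :* (d :* f)) :- Q :* (b :* (c :* f :+ d :* e :+ P :* (d :* f)))) refl P Q a b c d e f ,
        solve 8 (λ P Q a b c d e f → (a :* c :- Q :* (b :* d)) :* f :+ (a :* d :+ b :* c :+ P :* (b :* d)) :* e :+ P :* ((a :* d :+ b :* c :+ P :* (b :* d)) :* f)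
                  := a :* (c :* f :+ d :* e :+ P :* (d :* f)) :+ b :* (c :* e :- Q :* (d :* f)) :+ P :* (b :* (c :* f :+ d :* e :+ P :* (d :* f)))) refl P Q a b c d e f
      ⊗-identityˡ : ∀ x → (1# , 0#) ⊗ x A.≈ x
      ⊗-identityˡ (a , b) =
        solve 3 (λ Q a b → con (ℤ.+ 1) :* a :- Q :* (con (ℤ.+ 0) :* b) := a) refl Q a b ,
        solve 3 (λ P a b → con (ℤ.+ 1) :* b :+ con (ℤ.+ 0) :* a :+ P :* (con (ℤ.+ 0) :* b) := b) refl P a b
      ⊗-comm : ∀ x y → x ⊗ y A.≈ y ⊗ x
      ⊗-comm (a , b) (c , d) =
        solve 5 (λ Q a b c d → a :* c :- Q :* (b :* d) := c :* a :- Q :* (d :* b)) refl Q a b c d ,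
        solve 5 (λ P a b c d → a :* d :+ b :* c :+ P :* (b :* d) := c :* b :+ d :* a :+ P :* (d :* b)) refl P a b c d
      ⊗-distribʳ : ∀ x y z → (y A.∙ z) ⊗ x A.≈ (y ⊗ x) A.∙ (z ⊗ x)
      ⊗-distribʳ (a , b) (c , d) (e , f) =
        solve 7 (λ Q a b c d e f → (c :+ e) :* a :- Q :* ((d :+ f) :* b) := (c :* a :- Q :* (d :* b)) :+ (e :* a :- Q :* (f :* b))) refl Q a b c d e f ,
        solve 7 (λ P a b c d e f → (c :+ e) :* b :+ (d :+ f) :* a :+ P :* ((d :+ f) :* b) := (c :* b :+ d :* a :+ P :* (d :* b)) :+ (e :* b :+ f :* a :+ P :* (f :* b))) refl P a b c d e f
      ⊗-zeroˡ : ∀ x → A.ε ⊗ x A.≈ A.ε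
      ⊗-zeroˡ (a , b) =
        solve 3 (λ Q a b → con (ℤ.+ 0) :* a :- Q :* (con (ℤ.+ 0) :* b) := con (ℤ.+ 0)) refl Q a b ,
        solve 3 (λ P a b → con (ℤ.+ 0) :* b :+ con (ℤ.+ 0) :* a :+ P :* (con (ℤ.+ 0) :* b) := con (ℤ.+ 0)) refl P a b

  private
    module S = CommutativeSemiring R[α]
    U : ℕ → Carrier
    U = lucasU R P Q
  open import Algebra.Properties.Semiring.Exp S.semiring using (_^_; ^-congˡ; ^-assocʳ)
  open import Algebra.Properties.CommutativeSemiring.Exp R[α] using (^-distrib-*)
  open import Algebra.Properties.Semiring.Mult S.semiring using () renaming (_×_ to _·_)
  open import Algebra.Properties.CommutativeSemigroup S.*-commutativeSemigroup using () renaming (interchange to ⊗-interchange)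
  open import Algebra.Properties.Group +-group using (∙-cancelˡ)
  open import Relation.Binary.Reasoning.Setoid S.setoid

  infix 4 _≈ₛ_
  infixl 6 _⊕_
  _≈ₛ_ : S.Carrier → S.Carrier → Set ℓ
  _≈ₛ_ = S._≈_
  _⊕_ : S.Carrier → S.Carrier → S.Carrier
  _⊕_ = S._+_

  ι : Carrier → S.Carrier
  ι a = a , 0#

  ι-* : ∀ a b → ι a ⊗ ι b ≈ₛ ι (a * b)
  ι-* a b =
    solve 3 (λ Q a b → a :* b :- Q :* (con (ℤ.+ 0) :* con (ℤ.+ 0)) := a :* b) refl Q a b ,
    solve 3 (λ P a b → a :* con (ℤ.+ 0) :+ con (ℤ.+ 0) :* b :+ P :* (con (ℤ.+ 0) :* con (ℤ.+ 0)) := con (ℤ.+ 0)) refl P a b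

  ι-power : ∀ a n → ι a ^ n ≈ₛ ι (power R a n)
  ι-power a zero    = S.refl
  ι-power a (suc n) = S.trans (S.*-congˡ (ι-power a n)) (ι-* a (power R a n))

  ·-ι : ∀ n → n · S.1# ≈ₛ ι (natCast R n)
  ·-ι zero    = S.refl
  ·-ι (suc n) = S.trans (S.+-congˡ (·-ι n)) (refl , +-identityˡ 0#)

  ⊕-cancelˡ : ∀ z x y → z ⊕ x ≈ₛ z ⊕ y → x ≈ₛ y
  ⊕-cancelˡ (z₁ , z₂) (x₁ , x₂) (y₁ , y₂) (e₁ , e₂) = ∙-cancelˡ z₁ x₁ y₁ e₁ , ∙-cancelˡ z₂ x₂ y₂ e₂

  α β δ : S.Carrier
  α = 0# , 1#
  β = P , - 1#
  δ = - P , 1# + 1#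

  α^n : ∀ n → α ^ n ≈ₛ (U (suc n) - P * U n , U n)
  α^n zero    = solve 1 (λ P → con (ℤ.+ 1) := con (ℤ.+ 1) :- P :* con (ℤ.+ 0)) refl P , refl
  α^n (suc n) = S.trans (S.*-congˡ (α^n n))
    ( solve 4 (λ P Q u₀ u₁ → con (ℤ.+ 0) :* (u₁ :- P :* u₀) :- Q :* (con (ℤ.+ 1) :* u₀) := (P :* u₁ :- Q :* u₀) :- P :* u₁) refl P Q (U n) (U (suc n))
    , solve 3 (λ P u₀ u₁ → con (ℤ.+ 0) :* u₀ :+ con (ℤ.+ 1) :* (u₁ :- P :* u₀) :+ P :* (con (ℤ.+ 1) :* u₀) := u₁) refl P (U n) (U (suc n)) )

  β^n : ∀ n → β ^ n ≈ₛ (U (suc n) , - U n)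
  β^n zero    = refl , solve 0 (con (ℤ.+ 0) := :- con (ℤ.+ 0)) refl
  β^n (suc n) = S.trans (S.*-congˡ (β^n n))
    ( solve 4 (λ P Q u₀ u₁ → P :* u₁ :- Q :* ((:- con (ℤ.+ 1)) :* (:- u₀)) := P :* u₁ :- Q :* u₀) refl P Q (U n) (U (suc n))
    , solve 3 (λ P u₀ u₁ → P :* (:- u₀) :+ (:- con (ℤ.+ 1)) :* u₁ :+ P :* ((:- con (ℤ.+ 1)) :* (:- u₀)) := :- u₁) refl P (U n) (U (suc n)) )

  α^n≈β^n⊕Uₙδ : ∀ n → α ^ n ≈ₛ β ^ n ⊕ ι (U n) ⊗ δ
  α^n≈β^n⊕Uₙδ n = S.trans (α^n n) (S.trans
    ( solve 4 (λ P Q u₀ u₁ → u₁ :- P :* u₀ := u₁ :+ (u₀ :* (:- P) :- Q :* (con (ℤ.+ 0) :* con (ℤ.+ 2)))) refl P Q (U n) (U (suc n))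
    , solve 2 (λ P u₀ → u₀ := (:- u₀) :+ (u₀ :* con (ℤ.+ 2) :+ con (ℤ.+ 0) :* (:- P) :+ P :* (con (ℤ.+ 0) :* con (ℤ.+ 2)))) refl P (U n) )
    (S.+-congʳ (S.sym (β^n n))))

  δ²≈Δ : δ ⊗ δ ≈ₛ ι (discriminant R P Q)
  δ²≈Δ =
    trans (solve 2 (λ P Q → (:- P) :* (:- P) :- Q :* (con (ℤ.+ 2) :* con (ℤ.+ 2)) := P :* P :- con (ℤ.+ 4) :* Q) refl P Q)
          (+-congˡ (-‿cong (*-congʳ (sym (natCast≈· 4))))) ,
    solve 1 (λ P → (:- P) :* con (ℤ.+ 2) :+ con (ℤ.+ 2) :* (:- P) :+ P :* (con (ℤ.+ 2) :* con (ℤ.+ 2)) := con (ℤ.+ 0)) refl P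

  [uδ]²≈u²Δ : ∀ u → (ι u ⊗ δ) ⊗ (ι u ⊗ δ) ≈ₛ ι (u * u * discriminant R P Q)
  [uδ]²≈u²Δ u = S.trans (⊗-interchange (ι u) δ (ι u) δ) (S.trans (S.*-cong (ι-* u u) δ²≈Δ) (ι-* (u * u) _))

  lucasU-frobenius : ∀ {p} → Prime p → natCast R p ≈ 0# → ∀ m →
    U (m ℕ.* p) * U (m ℕ.* p) * discriminant R P Q ≈ power R (U m * U m * discriminant R P Q) p
  lucasU-frobenius {p} p-prime char m = proj₁ (begin
    ι (U (m ℕ.* p) * U (m ℕ.* p) * Δ)  ≈⟨ [uδ]²≈u²Δ (U (m ℕ.* p)) ⟨
    Y ⊗ Y                              ≈⟨ S.*-cong Y≈Xᵖ Y≈Xᵖ ⟩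
    X ^ p ⊗ X ^ p                      ≈⟨ ^-distrib-* X X p ⟨
    (X ⊗ X) ^ p                        ≈⟨ ^-congˡ p ([uδ]²≈u²Δ (U m)) ⟩
    ι (U m * U m * Δ) ^ p              ≈⟨ ι-power _ p ⟩
    ι (power R (U m * U m * Δ) p)      ∎)
    where
      Δ : Carrier
      Δ = discriminant R P Q
      X Y : S.Carrier
      X = ι (U m) ⊗ δ
      Y = ι (U (m ℕ.* p)) ⊗ δ
      Y≈Xᵖ : Y ≈ₛ X ^ p
      Y≈Xᵖ = ⊕-cancelˡ (β ^ (m ℕ.* p)) Y (X ^ p) (begin
        β ^ (m ℕ.* p) ⊕ Y      ≈⟨ α^n≈β^n⊕Uₙδ (m ℕ.* p) ⟨
        α ^ (m ℕ.* p)          ≈⟨ ^-assocʳ α m p ⟨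
        (α ^ m) ^ p            ≈⟨ ^-congˡ p (α^n≈β^n⊕Uₙδ m) ⟩
        (β ^ m ⊕ X) ^ p        ≈⟨ frobenius R[α] p-prime (S.trans (·-ι p) (char , refl)) (β ^ m) X ⟩
        (β ^ m) ^ p ⊕ X ^ p    ≈⟨ S.+-congʳ (^-assocʳ β m p) ⟩
        β ^ (m ℕ.* p) ⊕ X ^ p  ∎)

open QuadraticAlgebra using (lucasU-frobenius)

module _ {c ℓ} (R : CommutativeRing c ℓ) where
  open CommutativeRing R
  open IntegerCoefficientSolver R
  open import Algebra.Properties.CommutativeSemigroup *-commutativeSemigroup
    using () renaming (interchange to *-interchange)
  open import Algebra.Properties.Semiring.Mult.TCOptimised semiring using (×1-homo-*) renaming (_×_ to _·_)
  open import Relation.Binary.Reasoning.Setoid setoid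

  -- Divisibility and congruences

  infix 4 _∣_ _∤_
  _∣_ _∤_ : Carrier → Carrier → Set (c ⊔ ℓ)
  _∣_ = Divides R
  a ∤ x = ¬ a ∣ x

  ∣-respʳ : ∀ {a x y} → x ≈ y → a ∣ x → a ∣ y
  ∣-respʳ x≈y (q , qa≈x) = q , trans qa≈x x≈y

  ∣-respˡ : ∀ {a b x} → a ≈ b → a ∣ x → b ∣ x
  ∣-respˡ a≈b (q , qa≈x) = q , trans (*-congˡ (sym a≈b)) qa≈x

  ∣-refl : ∀ {a} → a ∣ a
  ∣-refl = 1# , *-identityˡ _

  ∣-trans : ∀ {a b x} → a ∣ b → b ∣ x → a ∣ x
  ∣-trans (q , qa≈b) (r , rb≈x) = r * q , trans (*-assoc _ _ _) (trans (*-congˡ qa≈b) rb≈x)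

  1∣ : ∀ x → 1# ∣ x
  1∣ x = x , *-identityʳ x

  ∣0 : ∀ a → a ∣ 0#
  ∣0 a = 0# , zeroˡ a

  ∣n⇒∣m*n : ∀ {a n} m → a ∣ n → a ∣ m * n
  ∣n⇒∣m*n m (q , qa≈n) = m * q , trans (*-assoc _ _ _) (*-congˡ qa≈n)

  ∣m⇒∣m*n : ∀ {a m} n → a ∣ m → a ∣ m * n
  ∣m⇒∣m*n n a∣m = ∣-respʳ (*-comm _ _) (∣n⇒∣m*n n a∣m)

  *-mono-∣ : ∀ {a b x y} → a ∣ x → b ∣ y → a * b ∣ x * y
  *-mono-∣ (q , qa≈x) (r , rb≈y) = q * r , trans (*-interchange q r _ _) (*-cong qa≈x rb≈y)

  ∣-+ : ∀ {a x y} → a ∣ x → a ∣ y → a ∣ x + y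
  ∣-+ (q , qa≈x) (r , ra≈y) = q + r , trans (distribʳ _ q r) (+-cong qa≈x ra≈y)

  ∣-neg : ∀ {a x} → a ∣ x → a ∣ - x
  ∣-neg {a} (q , qa≈x) = - q , trans (solve 2 (λ q a → (:- q) :* a := :- (q :* a)) refl q a) (-‿cong qa≈x)

  ∣-unit : ∀ {a u} → a ∣ u → IsUnit R u → IsUnit R a
  ∣-unit (q , qa≈u) (v , uv≈1) = q * v ,
    trans (solve 3 (λ a q v → a :* (q :* v) := (q :* a) :* v) refl _ q v) (trans (*-congʳ qa≈u) uv≈1)

  1-isUnit : IsUnit R 1#
  1-isUnit = 1# , *-identityˡ 1#

  power-homo-+ : ∀ x m n → power R x (m ℕ.+ n) ≈ power R x m * power R x n
  power-homo-+ x zero    n = sym (*-identityˡ _)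
  power-homo-+ x (suc m) n = trans (*-congˡ (power-homo-+ x m n)) (sym (*-assoc _ _ _))

  power-mono-∣ : ∀ {x m n} → m ≤ n → power R x m ∣ power R x n
  power-mono-∣ z≤n       = 1∣ _
  power-mono-∣ (s≤s m≤n) = *-mono-∣ ∣-refl (power-mono-∣ m≤n)

  infix 4 _≡_mod_
  _≡_mod_ : Carrier → Carrier → Carrier → Set (c ⊔ ℓ)
  x ≡ y mod a = a ∣ x - y

  module _ {a : Carrier} where

    ≡-mod-reflexive : ∀ {x y} → x ≈ y → x ≡ y mod a
    ≡-mod-reflexive {y = y} x≈y = ∣-respʳ (sym (trans (+-congʳ x≈y) (-‿inverseʳ y))) (∣0 a)

    ≡-mod-sym : ∀ {x y} → x ≡ y mod a → y ≡ x mod a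
    ≡-mod-sym {x} {y} = ∣-respʳ (solve 2 (λ x y → :- (x :- y) := y :- x) refl x y) ∘ ∣-neg

    ≡-mod-trans : ∀ {x y z} → x ≡ y mod a → y ≡ z mod a → x ≡ z mod a
    ≡-mod-trans {x} {y} {z} x≡y y≡z =
      ∣-respʳ (solve 3 (λ x y z → (x :- y) :+ (y :- z) := x :- z) refl x y z) (∣-+ x≡y y≡z)

    ≡-mod-+ : ∀ {x x′ y y′} → x ≡ x′ mod a → y ≡ y′ mod a → x + y ≡ x′ + y′ mod a
    ≡-mod-+ {x} {x′} {y} {y′} x≡x′ y≡y′ = ∣-respʳ
      (solve 4 (λ x x′ y y′ → (x :- x′) :+ (y :- y′) := (x :+ y) :- (x′ :+ y′)) refl x x′ y y′)
      (∣-+ x≡x′ y≡y′)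

    ≡-mod-* : ∀ {x x′ y y′} → x ≡ x′ mod a → y ≡ y′ mod a → x * y ≡ x′ * y′ mod a
    ≡-mod-* {x} {x′} {y} {y′} x≡x′ y≡y′ = ∣-respʳ
      (solve 4 (λ x x′ y y′ → (x :- x′) :* y :+ x′ :* (y :- y′) := x :* y :- x′ :* y′) refl x x′ y y′)
      (∣-+ (∣m⇒∣m*n y x≡x′) (∣n⇒∣m*n x′ y≡y′))

    ≡-mod-+-multiple : ∀ {x z} → a ∣ z → x + z ≡ x mod a
    ≡-mod-+-multiple {x} {z} a∣z = ∣-respʳ (solve 2 (λ x z → z := (x :+ z) :- x) refl x z) a∣z

    ≡-mod-∣ : ∀ {x y} → x ≡ y mod a → a ∣ x → a ∣ y
    ≡-mod-∣ {x} {y} x≡y a∣x = ∣-respʳ (solve 2 (λ x y → x :+ :- (x :- y) := y) refl x y) (∣-+ a∣x (∣-neg x≡y))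

  ≡-mod-weaken : ∀ {a b x y} → b ∣ a → x ≡ y mod a → x ≡ y mod b
  ≡-mod-weaken = ∣-trans

  natCast-* : ∀ m n → natCast R (m ℕ.* n) ≈ natCast R m * natCast R n
  natCast-* m n = begin
    natCast R (m ℕ.* n)        ≈⟨ natCast≈· (m ℕ.* n) ⟩
    (m ℕ.* n) · 1#             ≈⟨ ×1-homo-* m n ⟩
    m · 1# * n · 1#            ≈⟨ *-cong (natCast≈· m) (natCast≈· n) ⟨
    natCast R m * natCast R n  ∎

  natCast-isUnit : ∀ {p j} → Prime p → natCast R p ≈ 0# → ¬ p ℕ.∣ j → IsUnit R (natCast R j)
  natCast-isUnit {p} {j} p-prime char p∤j = fromBézout (coprime-Bézout (prime∤⇒coprime p-prime p∤j))
    where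
      natCast-*p : ∀ x → natCast R (x ℕ.* p) ≈ 0#
      natCast-*p x = trans (natCast-* x p) (trans (*-congˡ char) (zeroʳ _))

      fromBézout : GCD.Bézout.Identity 1 p j → IsUnit R (natCast R j)
      fromBézout (GCD.Bézout.+- x y 1+yj≡xp) = - natCast R y , (begin
        natCast R j * - natCast R y            ≈⟨ solve 2 (λ j y → j :* (:- y) := con (ℤ.+ 1) :- (con (ℤ.+ 1) :+ y :* j)) refl _ _ ⟩
        1# - (1# + natCast R y * natCast R j)  ≈⟨ +-congˡ (-‿cong (+-congˡ (natCast-* y j))) ⟨
        1# - natCast R (1 ℕ.+ y ℕ.* j)         ≡⟨ ≡.cong (λ k → 1# - natCast R k) 1+yj≡xp ⟩
        1# - natCast R (x ℕ.* p)               ≈⟨ +-congˡ (-‿cong (natCast-*p x)) ⟩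
        1# - 0#                                ≈⟨ solve 0 (con (ℤ.+ 1) :- con (ℤ.+ 0) := con (ℤ.+ 1)) refl ⟩
        1#                                     ∎)
      fromBézout (GCD.Bézout.-+ x y 1+xp≡yj) = natCast R y , (begin
        natCast R j * natCast R y              ≈⟨ *-comm _ _ ⟩
        natCast R y * natCast R j              ≈⟨ natCast-* y j ⟨
        natCast R (y ℕ.* j)                    ≡⟨ ≡.cong (natCast R) 1+xp≡yj ⟨
        1# + natCast R (x ℕ.* p)               ≈⟨ +-congˡ (natCast-*p x) ⟩
        1# + 0#                                ≈⟨ +-identityʳ 1# ⟩
        1#                                     ∎)

  module _ (P Q : Carrier) where

    private
      U : ℕ → Carrier
      U = lucasU R P Q

    lucasU-+ : ∀ m n → U (suc (m ℕ.+ n)) ≈ U (suc m) * U (suc n) - Q * U m * U n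
    lucasU-+ zero          n = solve 4 (λ P Q u₀ u₁ → u₁ := con (ℤ.+ 1) :* u₁ :- Q :* con (ℤ.+ 0) :* u₀) refl P Q (U n) (U (suc n))
    lucasU-+ (suc zero)    n = solve 4 (λ P Q u₀ u₁ → P :* u₁ :- Q :* u₀ := (P :* con (ℤ.+ 1) :- Q :* con (ℤ.+ 0)) :* u₁ :- Q :* con (ℤ.+ 1) :* u₀) refl P Q (U n) (U (suc n))
    lucasU-+ (suc (suc m)) n = trans (+-cong (*-congˡ (lucasU-+ (suc m) n)) (-‿cong (*-congˡ (lucasU-+ m n))))
      (solve 6 (λ P Q v₀ v₁ u₀ u₁ → P :* ((P :* v₁ :- Q :* v₀) :* u₁ :- Q :* v₁ :* u₀) :- Q :* (v₁ :* u₁ :- Q :* v₀ :* u₀)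
                 := (P :* (P :* v₁ :- Q :* v₀) :- Q :* v₁) :* u₁ :- Q :* (P :* v₁ :- Q :* v₀) :* u₀) refl P Q (U m) (U (suc m)) (U n) (U (suc n)))

    lucasU-≡-power : ∀ n → U (suc n) ≡ power R P n mod Q
    lucasU-≡-power zero    = ≡-mod-reflexive refl
    lucasU-≡-power (suc n) = ≡-mod-trans (≡-mod-+-multiple (∣-neg (∣m⇒∣m*n (U n) ∣-refl)))
                                          (≡-mod-* (≡-mod-reflexive refl) (lucasU-≡-power n))

  -- Valuations at a prime element

  module _ (domain : IsIntegralDomain R) where

    *-cancelˡ : ∀ {z x y} → ¬ z ≈ 0# → z * x ≈ z * y → x ≈ y
    *-cancelˡ {z} {x} {y} z≉0 zx≈zy with proj₂ domain z (x - y) z[x-y]≈0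
      where
        z[x-y]≈0 : z * (x - y) ≈ 0#
        z[x-y]≈0 = trans (solve 3 (λ z x y → z :* (x :- y) := z :* x :- z :* y) refl z x y)
                         (trans (+-congʳ zx≈zy) (-‿inverseʳ _))
    ... | inj₁ z≈0   = ⊥-elim (z≉0 z≈0)
    ... | inj₂ x-y≈0 = begin
      x              ≈⟨ solve 2 (λ x y → x := (x :- y) :+ y) refl x y ⟩
      (x - y) + y    ≈⟨ +-congʳ x-y≈0 ⟩
      0# + y         ≈⟨ +-identityˡ y ⟩
      y              ∎

    *-cancelˡ-∣ : ∀ {z x y} → ¬ z ≈ 0# → z * x ∣ z * y → x ∣ y
    *-cancelˡ-∣ {z} {x} z≉0 (q , qzx≈zy) = q , *-cancelˡ z≉0 (trans (solve 3 (λ z q x → z :* (q :* x) := q :* (z :* x)) refl z q x) qzx≈zy)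

    power-≉0 : ∀ {x} n → ¬ x ≈ 0# → ¬ power R x n ≈ 0#
    power-≉0 zero    _   1≈0 = proj₁ domain 1≈0
    power-≉0 (suc n) x≉0 xxⁿ≈0 with proj₂ domain _ _ xxⁿ≈0
    ... | inj₁ x≈0  = x≉0 x≈0
    ... | inj₂ xⁿ≈0 = power-≉0 n x≉0 xⁿ≈0

    module _ {π} (π-prime : IsPrimeElement R π) where

      private
        π≉0 : ¬ π ≈ 0#
        π≉0 = proj₁ π-prime
        π∣*⇒ : ∀ {x y} → π ∣ x * y → π ∣ x ⊎ π ∣ y
        π∣*⇒ = proj₂ (proj₂ π-prime) _ _

      π∤unit : ∀ {u} → IsUnit R u → π ∤ u
      π∤unit u-unit π∣u = proj₁ (proj₂ π-prime) (∣-unit π∣u u-unit)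

      π∤* : ∀ {x y} → π ∤ x → π ∤ y → π ∤ x * y
      π∤* π∤x π∤y π∣xy with π∣*⇒ π∣xy
      ... | inj₁ π∣x = π∤x π∣x
      ... | inj₂ π∣y = π∤y π∣y

      π∤power : ∀ {x} n → π ∤ x → π ∤ power R x n
      π∤power zero    _   = π∤unit 1-isUnit
      π∤power (suc n) π∤x = π∤* π∤x (π∤power n π∤x)

      IsVal-resp : ∀ {x y k} → x ≈ y → IsVal R π x k → IsVal R π y k
      IsVal-resp x≈y (πᵏ∣x , πᵏ⁺¹∤x) = ∣-respʳ x≈y πᵏ∣x , πᵏ⁺¹∤x ∘ ∣-respʳ (sym x≈y)

      IsVal⇒factor : ∀ {x k} → IsVal R π x k → ∃ λ u → x ≈ power R π k * u × π ∤ u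
      IsVal⇒factor {x} {k} ((u , uπᵏ≈x) , πᵏ⁺¹∤x) = u , trans (sym uπᵏ≈x) (*-comm _ _) , π∤u
        where
          π∤u : π ∤ u
          π∤u (q , qπ≈u) = πᵏ⁺¹∤x (q , trans (sym (*-assoc _ _ _)) (trans (*-congʳ qπ≈u) uπᵏ≈x))

      factor⇒IsVal : ∀ {u} k → π ∤ u → IsVal R π (power R π k * u) k
      factor⇒IsVal {u} k π∤u = (u , *-comm _ _) , πᵏ⁺¹∤πᵏu
        where
          πᵏ⁺¹∤πᵏu : π * power R π k ∤ power R π k * u
          πᵏ⁺¹∤πᵏu (q , qππᵏ≈πᵏu) = π∤u (q , *-cancelˡ (power-≉0 k π≉0)
            (trans (solve 3 (λ a q π → a :* (q :* π) := q :* (π :* a)) refl (power R π k) q π) qππᵏ≈πᵏu))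

      IsVal-π : IsVal R π π 1
      IsVal-π = IsVal-resp {k = 1} (trans (*-identityʳ _) (*-identityʳ π)) (factor⇒IsVal 1 (π∤unit 1-isUnit))

      IsVal-* : ∀ {x y a b} → IsVal R π x a → IsVal R π y b → IsVal R π (x * y) (a ℕ.+ b)
      IsVal-* {x} {y} {a} {b} vx vy with IsVal⇒factor {k = a} vx | IsVal⇒factor {k = b} vy
      ... | u , x≈πᵃu , π∤u | v , y≈πᵇv , π∤v = IsVal-resp {k = a ℕ.+ b} (sym (begin
        x * y                                        ≈⟨ *-cong x≈πᵃu y≈πᵇv ⟩
        (power R π a * u) * (power R π b * v)        ≈⟨ *-interchange _ _ _ _ ⟩
        (power R π a * power R π b) * (u * v)        ≈⟨ *-congʳ (power-homo-+ π a b) ⟨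
        power R π (a ℕ.+ b) * (u * v)                ∎))
        (factor⇒IsVal (a ℕ.+ b) (π∤* π∤u π∤v))

      IsVal-1 : IsVal R π 1# 0
      IsVal-1 = IsVal-resp {k = 0} (*-identityˡ 1#) (factor⇒IsVal 0 (π∤unit 1-isUnit))

      IsVal-power : ∀ {x a} → IsVal R π x a → ∀ n → IsVal R π (power R x n) (n ℕ.* a)
      IsVal-power     vx zero    = IsVal-1
      IsVal-power {a = a} vx (suc n) = IsVal-* {a = a} {b = n ℕ.* a} vx (IsVal-power vx n)

      IsVal-π^*-cancel : ∀ {d w M} → IsVal R π (power R π d * w) M → d ≤ M × IsVal R π w (M ∸ d)
      IsVal-π^*-cancel {d} {w} {M} v with d ℕ.≤? M
      ... | no  d≰M = ⊥-elim (proj₂ v (∣m⇒∣m*n w (power-mono-∣ (ℕ.≰⇒> d≰M))))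
      ... | yes d≤M = d≤M , cancel (≡.subst (IsVal R π _) (≡.sym (ℕ.m+[n∸m]≡n d≤M)) v)
        where
          πᵈ≉0 : ¬ power R π d ≈ 0#
          πᵈ≉0 = power-≉0 d π≉0
          cancel : ∀ {t} → IsVal R π (power R π d * w) (d ℕ.+ t) → IsVal R π w t
          cancel {t} (πᵈ⁺ᵗ∣πᵈw , πᵈ⁺ᵗ⁺¹∤πᵈw) =
            *-cancelˡ-∣ πᵈ≉0 (∣-respˡ (power-homo-+ π d t) πᵈ⁺ᵗ∣πᵈw) ,
            λ πᵗ⁺¹∣w → πᵈ⁺ᵗ⁺¹∤πᵈw (∣-respˡ (trans (sym (power-homo-+ π d (suc t))) (reflexive (≡.cong (power R π) (ℕ.+-suc d t))))
                                           (*-mono-∣ ∣-refl πᵗ⁺¹∣w))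

      π∣y*y*c⇒π∣y : ∀ {c y} → π ∤ c → π ∣ y * y * c → π ∣ y
      π∣y*y*c⇒π∣y π∤c π∣yyc with π∣*⇒ π∣yyc
      ... | inj₂ π∣c  = ⊥-elim (π∤c π∣c)
      ... | inj₁ π∣yy with π∣*⇒ π∣yy
      ...   | inj₁ π∣y = π∣y
      ...   | inj₂ π∣y = π∣y

      π∤⇒IsVal-0 : ∀ {w} → π ∤ w → IsVal R π w 0
      π∤⇒IsVal-0 {w} π∤w = IsVal-resp {k = 0} (*-identityˡ w) (factor⇒IsVal 0 π∤w)

      IsVal-square : ∀ {c y} N → π ∤ c → IsVal R π (y * y * c) N → ∃ λ f → IsVal R π y f × N ≡ f ℕ.+ f
      IsVal-square {c} {y} zero π∤c (_ , π∤yyc) =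
        0 , (1∣ y , π∤yyc ∘ ∣m⇒∣m*n c ∘ ∣m⇒∣m*n y) , ≡.refl
      IsVal-square {c} {y} (suc zero) π∤c (π∣yyc , π²∤yyc) =
        ⊥-elim (π²∤yyc (∣m⇒∣m*n c (*-mono-∣ π∣y (∣-respˡ (sym (*-identityʳ π)) π∣y))))
        where π∣y = π∣y*y*c⇒π∣y π∤c (∣-respˡ (*-identityʳ π) π∣yyc)
      IsVal-square {c} {y} (suc (suc N)) π∤c v@(πᴺ⁺²∣yyc , _) =
        let q , qπ≈y       = π∣y*y*c⇒π∣y π∤c (∣-trans (∣m⇒∣m*n _ ∣-refl) πᴺ⁺²∣yyc)
            vqqc           = IsVal-π^*-cancel {d = 2} {M = suc (suc N)} (IsVal-resp {k = suc (suc N)} (yyc≈π²qqc qπ≈y) v)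
            f , vq , N≡f+f = IsVal-square N π∤c (proj₂ vqqc)
        in suc f , IsVal-resp {k = suc f} (trans (*-comm π q) qπ≈y) (IsVal-* {a = 1} {b = f} IsVal-π vq) ,
           ≡.trans (≡.cong (suc ∘ suc) N≡f+f) (≡.cong suc (≡.sym (ℕ.+-suc f f)))
        where
          yyc≈π²qqc : ∀ {q} → q * π ≈ y → y * y * c ≈ power R π 2 * (q * q * c)
          yyc≈π²qqc {q} qπ≈y = trans (*-congʳ (*-cong (sym qπ≈y) (sym qπ≈y)))
            (solve 3 (λ q π c → q :* π :* (q :* π) :* c := π :* (π :* con (ℤ.+ 1)) :* (q :* q :* c)) refl q π c)

      -- The valuation of y is not assumed to exist: it is read off from that of y²z.
      IsVal-square* : ∀ {y z M d} → IsVal R π (y * y * z) M → IsVal R π z d →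
                      ∃ λ f → IsVal R π y f × f ℕ.+ f ℕ.+ d ≡ M
      IsVal-square* {y} {z} {M} {d} v vz =
        let u , z≈πᵈu , π∤u  = IsVal⇒factor {k = d} vz
            d≤M , vyyu       = IsVal-π^*-cancel {d = d} {M = M} (IsVal-resp {k = M} (yyz≈πᵈyyu z≈πᵈu) v)
            f , vf , M∸d≡f+f = IsVal-square (M ∸ d) π∤u vyyu
        in f , vf , ≡.trans (≡.cong (ℕ._+ d) (≡.sym M∸d≡f+f)) (ℕ.m∸n+n≡m d≤M)
        where
          yyz≈πᵈyyu : ∀ {u} → z ≈ power R π d * u → y * y * z ≈ power R π d * (y * y * u)
          yyz≈πᵈyyu {u} z≈πᵈu = trans (*-congˡ z≈πᵈu)
            (solve 3 (λ y a u → y :* y :* (a :* u) := a :* (y :* y :* u)) refl y (power R π d) u)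

      module _ {P Q : Carrier} where

        private
          U : ℕ → Carrier
          U = lucasU R P Q
          Δ : Carrier
          Δ = discriminant R P Q

        lucasU-IsVal-*p : ∀ {p m e d} → Prime p → natCast R p ≈ 0# → IsVal R π (U m) e → IsVal R π Δ d →
          ∃ λ f → IsVal R π (U (m ℕ.* p)) f × f ℕ.+ f ℕ.+ d ≡ p ℕ.* (e ℕ.+ e ℕ.+ d)
        lucasU-IsVal-*p {p} {m} {e} {d} p-prime char vU vΔ = IsVal-square* {M = p ℕ.* (e ℕ.+ e ℕ.+ d)} {d = d}
          (IsVal-resp {k = p ℕ.* (e ℕ.+ e ℕ.+ d)} (sym (lucasU-frobenius R P Q p-prime char m))
            (IsVal-power {a = e ℕ.+ e ℕ.+ d} (IsVal-* {a = e ℕ.+ e} {b = d} (IsVal-* {a = e} {b = e} vU vU) vΔ) p))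
          vΔ

        lucasU-IsVal-*p^ : ∀ {p m b d} → Prime p → natCast R p ≈ 0# → IsVal R π (U m) b → IsVal R π Δ d →
          ∀ k → ∃ λ a → IsVal R π (U (m ℕ.* p ℕ.^ k)) a × a ℕ.+ a ℕ.+ d ≡ p ℕ.^ k ℕ.* (b ℕ.+ b ℕ.+ d)
        lucasU-IsVal-*p^ {p} {m} {b} {d} p-prime char vU vΔ zero =
          b , ≡.subst (λ i → IsVal R π (U i) b) (≡.sym (ℕ.*-identityʳ m)) vU , ≡.sym (ℕ.*-identityˡ _)
        lucasU-IsVal-*p^ {p} {m} {b} {d} p-prime char vU vΔ (suc k) =
          let a , va , eqₐ  = lucasU-IsVal-*p^ {p} {m} {b} {d} p-prime char vU vΔ k
              f , vf , eq_f = lucasU-IsVal-*p {p} {m ℕ.* p ℕ.^ k} {a} {d} p-prime char va vΔ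
          in f , ≡.subst (λ i → IsVal R π (U i) f) index vf ,
             ≡.trans eq_f (≡.trans (≡.cong (p ℕ.*_) eqₐ) (≡.sym (ℕ.*-assoc p (p ℕ.^ k) _)))
          where
            index : m ℕ.* p ℕ.^ k ℕ.* p ≡ m ℕ.* p ℕ.^ suc k
            index = ≡.trans (ℕ.*-assoc m (p ℕ.^ k) p) (≡.cong (m ℕ.*_) (ℕ.*-comm (p ℕ.^ k) p))

        module _ (PQ-coprime : ∃₂ λ x y → x * P + y * Q ≈ 1#) where

          π∤Q : ∀ {r} → π ∣ U (suc r) → π ∤ Q
          π∤Q {r} π∣Uρ π∣Q = π∤power r π∤P (≡-mod-∣ (≡-mod-weaken π∣Q (lucasU-≡-power P Q r)) π∣Uρ)
            where
              π∤P : π ∤ P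
              π∤P π∣P = let x , y , xP+yQ≈1 = PQ-coprime in
                π∤unit 1-isUnit (∣-respʳ xP+yQ≈1 (∣-+ (∣n⇒∣m*n x π∣P) (∣n⇒∣m*n y π∣Q)))

          π∤consecutive : π ∤ Q → ∀ i → π ∣ U i → π ∤ U (suc i)
          π∤consecutive π∤Q zero    _ = π∤unit 1-isUnit
          π∤consecutive π∤Q (suc i) π∣Uᵢ₊₁ π∣Uᵢ₊₂ =
            [ π∤Q , (λ π∣Uᵢ → π∤consecutive π∤Q i π∣Uᵢ π∣Uᵢ₊₁) ]′
              (π∣*⇒ (∣-respʳ PUᵢ₊₁-Uᵢ₊₂≈QUᵢ (∣-+ (∣n⇒∣m*n P π∣Uᵢ₊₁) (∣-neg π∣Uᵢ₊₂))))
            where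
              PUᵢ₊₁-Uᵢ₊₂≈QUᵢ : P * U (suc i) - U (suc (suc i)) ≈ Q * U i
              PUᵢ₊₁-Uᵢ₊₂≈QUᵢ = solve 4 (λ P Q u₀ u₁ → P :* u₁ :- (P :* u₁ :- Q :* u₀) := Q :* u₀) refl P Q (U i) (U (suc i))

          module _ {r} (π∣Uρ : π ∣ U (suc r)) where

            private
              ρ : ℕ
              ρ = suc r

            cofactor : ℕ → Carrier
            cofactor zero    = 0#
            cofactor (suc j) = U (suc (j ℕ.* ρ)) - Q * U r * cofactor j

            lucasU-*ρ : ∀ j → U (j ℕ.* ρ) ≈ U ρ * cofactor j
            lucasU-*ρ zero    = sym (zeroʳ _)
            lucasU-*ρ (suc j) = begin
              U (suc (r ℕ.+ j ℕ.* ρ))                                 ≈⟨ lucasU-+ P Q r (j ℕ.* ρ) ⟩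
              U ρ * U (suc (j ℕ.* ρ)) - Q * U r * U (j ℕ.* ρ)        ≈⟨ +-congˡ (-‿cong (*-congˡ (lucasU-*ρ j))) ⟩
              U ρ * U (suc (j ℕ.* ρ)) - Q * U r * (U ρ * cofactor j)        ≈⟨ solve 5 (λ u v q t w → u :* v :- q :* t :* (u :* w) := u :* (v :- q :* t :* w)) refl (U ρ) _ Q (U r) (cofactor j) ⟩
              U ρ * cofactor (suc j)                                        ∎

            lucasU-*ρ+1 : ∀ j → U (suc (j ℕ.* ρ)) ≡ power R (U (suc ρ)) j mod U ρ
            lucasU-*ρ+1 zero    = ≡-mod-reflexive refl
            lucasU-*ρ+1 (suc j) = ≡-mod-trans (≡-mod-reflexive (lucasU-+ P Q ρ (j ℕ.* ρ)))
              (≡-mod-trans (≡-mod-+-multiple (∣-neg (∣m⇒∣m*n _ (∣n⇒∣m*n Q ∣-refl))))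
                           (≡-mod-* (≡-mod-reflexive refl) (lucasU-*ρ+1 j)))

            cofactor≡ : ∀ j → cofactor (suc j) ≡ natCast R (suc j) * power R (U (suc ρ)) j mod U ρ
            cofactor≡ zero    = ≡-mod-reflexive (solve 2 (λ q t → con (ℤ.+ 1) :- q :* t :* con (ℤ.+ 0) := (con (ℤ.+ 1) :+ con (ℤ.+ 0)) :* con (ℤ.+ 1)) refl Q (U r))
            cofactor≡ (suc j) = ≡-mod-trans (≡-mod-reflexive regroup)
              (≡-mod-trans (≡-mod-+ (lucasU-*ρ+1 (suc j)) (≡-mod-* -QUᵣ≡Uρ₊₁ (cofactor≡ j))) (≡-mod-reflexive collect))
              where
                c′ : Carrier
                c′ = U (suc ρ)
                regroup : cofactor (suc (suc j)) ≈ U (suc (suc j ℕ.* ρ)) + - (Q * U r) * cofactor (suc j)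
                regroup = solve 4 (λ q t u w → u :- q :* t :* w := u :+ (:- (q :* t)) :* w) refl Q (U r) _ (cofactor (suc j))
                -QUᵣ≡Uρ₊₁ : - (Q * U r) ≡ c′ mod U ρ
                -QUᵣ≡Uρ₊₁ = ≡-mod-sym (≡-mod-trans (≡-mod-reflexive (+-comm _ _)) (≡-mod-+-multiple (∣n⇒∣m*n P ∣-refl)))
                collect : power R c′ (suc j) + c′ * (natCast R (suc j) * power R c′ j) ≈ natCast R (suc (suc j)) * power R c′ (suc j)
                collect = solve 3 (λ c n x → c :* x :+ c :* (n :* x) := (con (ℤ.+ 1) :+ n) :* (c :* x)) refl c′ (natCast R (suc j)) (power R c′ j)

            lucasU-IsVal-*ρ : ∀ {b} j → π ∤ natCast R (suc j) → IsVal R π (U ρ) b → IsVal R π (U (suc j ℕ.* ρ)) b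
            lucasU-IsVal-*ρ {b} j π∤j vUρ = IsVal-resp {k = b} (sym (lucasU-*ρ (suc j)))
              (≡.subst (IsVal R π _) (ℕ.+-identityʳ b) (IsVal-* {a = b} {b = 0} vUρ (π∤⇒IsVal-0 π∤cofactor)))
              where
                π∤Uρ₊₁ : π ∤ U (suc ρ)
                π∤Uρ₊₁ = π∤consecutive (π∤Q {r} π∣Uρ) ρ π∣Uρ
                π∤cofactor : π ∤ cofactor (suc j)
                π∤cofactor π∣cofactor = π∤* π∤j (π∤power j π∤Uρ₊₁) (≡-mod-∣ (≡-mod-weaken π∣Uρ (cofactor≡ j)) π∣cofactor)

-- Opened only here: unqualified, these would clash with the ring operations above.
open import Data.Nat using (_+_; _*_; _^_)
open import Data.Nat.Tactic.RingSolver using (solve-∀)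

2*a≡2*[q*b]+[q∸1]*d : ∀ {a b d q} → 1 ≤ q → a + a + d ≡ q * (b + b + d) → 2 * a ≡ 2 * (q * b) + (q ∸ 1) * d
2*a≡2*[q*b]+[q∸1]*d {a} {b} {d} {suc q} _ a+a+d≡ =
  ℕ.+-cancelʳ-≡ d _ _ (≡.trans (lhs a d) (≡.trans a+a+d≡ (rhs q b d)))
  where
    lhs : ∀ a d → 2 * a + d ≡ a + a + d
    lhs = solve-∀
    rhs : ∀ q b d → suc q * (b + b + d) ≡ 2 * (suc q * b) + q * d + d
    rhs = solve-∀

IsNatVal-cofactor : ∀ {p n k} → IsNatVal p n k → 1 ≤ n → ∃ λ j → n ≡ suc j * p ^ k × ¬ p ℕ.∣ suc j
IsNatVal-cofactor (ℕ.divides zero    n≡0     , _)      1≤n = ⊥-elim (ℕ.n≮0 (≡.subst (1 ≤_) n≡0 1≤n))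
IsNatVal-cofactor {p} {k = k} (ℕ.divides (suc j) n≡[1+j]pᵏ , pᵏ⁺¹∤n) _ =
  j , n≡[1+j]pᵏ , λ p∣1+j → pᵏ⁺¹∤n (≡.subst (p * p ^ k ℕ.∣_) (≡.sym n≡[1+j]pᵏ) (ℕ.*-monoˡ-∣ (p ^ k) p∣1+j))

mainTheorem2 : ∀ {c ℓ} (R : CommutativeRing c ℓ) → IsUFD R →
    (p : ℕ) → Prime p → HasCharacteristic R p →
    (P Q : CommutativeRing.Carrier R) →
    ¬ (CommutativeRing._≈_ R P (CommutativeRing.0# R)) →
    ¬ (CommutativeRing._≈_ R Q (CommutativeRing.0# R)) →
    Regular R P Q →
    (π : CommutativeRing.Carrier R) → IsPrimeElement R π →
    (ρ : ℕ) → IsRankOfAppearance R P Q π ρ →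
    (n : ℕ) → 1 ≤ n →
    (k b d : ℕ) → IsNatVal p n k →
    IsVal R π (lucasU R P Q ρ) b →
    IsVal R π (discriminant R P Q) d →
    ∃ λ a → IsVal R π (lucasU R P Q (ρ * n)) a
          × 2 * a ≡ 2 * (p ^ k * b) + (p ^ k ∸ 1) * d
mainTheorem2 R (domain , _) p p-prime (char , _) P Q _ _ (_ , PQ-coprime) π π-prime _ (s≤s {n = r} z≤n , π∣Uρ , _)
             n 1≤n k b d n-val vUρ vΔ =
  let j , n≡[1+j]pᵏ , p∤1+j = IsNatVal-cofactor {p} {n} {k} n-val 1≤n
      π∤1+j           = π∤unit R domain π-prime (natCast-isUnit R p-prime char p∤1+j)
      vU[1+j]ρ        = lucasU-IsVal-*ρ R domain π-prime {P} {Q} PQ-coprime {r} π∣Uρ {b} j π∤1+j vUρ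
      a , va , a+a+d≡ = lucasU-IsVal-*p^ R domain π-prime {P} {Q} {p} {suc j * suc r} {b} {d} p-prime char vU[1+j]ρ vΔ k
  in a , ≡.subst (λ i → IsVal R π (lucasU R P Q i) a) (index j n≡[1+j]pᵏ) va ,
     2*a≡2*[q*b]+[q∸1]*d {a} {b} {d} (ℕ.m^n>0 p ⦃ prime⇒nonZero p-prime ⦄ k) a+a+d≡
  where
    reassoc : ∀ j ρ q → j * ρ * q ≡ ρ * (j * q)
    reassoc = solve-∀
    index : ∀ j → n ≡ suc j * p ^ k → suc j * suc r * p ^ k ≡ suc r * n
    index j n≡[1+j]pᵏ = ≡.trans (reassoc (suc j) (suc r) (p ^ k)) (≡.cong (suc r *_) (≡.sym n≡[1+j]pᵏ))
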